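{- Let $n\ge 6$ and $k\ge 3$ be integers. Then $$\mathrm{sat}^{lin}_k(n,\text{Berge- }C_3)= \bigg\lfloor\frac{n-1}{k-1}\bigg\rfloor.$$
   Context: A hypergraph $H=(V(H),E(H))$ is $k$-uniform if every hyperedge is a $k$-element subset of $V(H)$, and linear if any two distinct hyperedges share at most one vertex. A Berge cycle Berge-$C_\ell$ of length $\ell$ in $H$ is an alternating sequence $(v_1,e_1,v_2,e_2,\dots,v_\ell,e_\ell)$ of distinct vertices $v_i$ and distinct hyperedges $e_i$ of $H$ with $v_i,v_{i+1}\in e_i$ for $1\le i\le \ell-1$ and $v_\ell,v_1\in e_\ell$. A linear $k$-uniform hypergraph $H$ is linear Berge-$C_t$-saturated if $H$ contains no Berge-$C_t$, but for every $e\in\binom{V(H)}{k}\setminus E(H)$ such that $H+e$ is still linear, $H+e$ contains a Berge-$C_t$. The linear saturation number $\mathrm{sat}^{lin}_k(n,\text{Berge- }C_t)$ is the minimum number of hyperedges of an $n$-vertex linear $k$-uniform hypergraph that is linear Berge-$C_t$-saturated. -}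

module Defs where

open import Data.Nat using (ℕ; zero; suc; _≤_; _/_)
open import Data.Fin using (Fin)
open import Data.Fin.Subset using (Subset; _∈_; _∩_; ∣_∣)
open import Data.List using (List; _∷_; length)
import Data.List.Membership.Propositional as L
open import Data.List.Relation.Unary.All using (All)
open import Data.List.Relation.Unary.Unique.Propositional using (Unique)
open import Data.Product using (Σ; ∃; _×_)
open import Relation.Binary.PropositionalEquality using (_≡_; _≢_)
open import Relation.Nullary using (¬_)

-- A k-uniform hypergraph on vertex set Fin n: a duplicate-free list of
-- hyperedges (subsets of Fin n), each of size k.  Its number of edges is
-- the length of the list.
Hypergraph : ℕ → Set
Hypergraph n = List (Subset n)

IsLinearUniform : {n : ℕ} → ℕ → Hypergraph n → Set
IsLinearUniform {n} k H =
  Unique H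
  × All (λ e → ∣ e ∣ ≡ k) H
  × (∀ (e f : Subset n) → e L.∈ H → f L.∈ H → e ≢ f → ∣ e ∩ f ∣ ≤ 1)

BergeC3 : {n : ℕ} → Hypergraph n → Set
BergeC3 {n} H =
  Σ (Fin n) λ v₁ → Σ (Fin n) λ v₂ → Σ (Fin n) λ v₃ →
  Σ (Subset n) λ e₁ → Σ (Subset n) λ e₂ → Σ (Subset n) λ e₃ →
    (v₁ ≢ v₂ × v₂ ≢ v₃ × v₁ ≢ v₃)
  × (e₁ ≢ e₂ × e₂ ≢ e₃ × e₁ ≢ e₃)
  × (e₁ L.∈ H × e₂ L.∈ H × e₃ L.∈ H)
  × (v₁ ∈ e₁ × v₂ ∈ e₁)
  × (v₂ ∈ e₂ × v₃ ∈ e₂)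
  × (v₃ ∈ e₃ × v₁ ∈ e₃)

IsLinSaturatedC3 : {n : ℕ} → ℕ → Hypergraph n → Set
IsLinSaturatedC3 {n} k H =
  IsLinearUniform k H
  × ¬ BergeC3 H
  × (∀ (e : Subset n) → ∣ e ∣ ≡ k → ¬ (e L.∈ H)
       → IsLinearUniform k (e ∷ H) → BergeC3 (e ∷ H))

IsLinSatNumberC3 : ℕ → ℕ → ℕ → Set
IsLinSatNumberC3 n k m =
  (Σ (Hypergraph n) λ H → IsLinSaturatedC3 k H × length H ≡ m)
  × (∀ (H : Hypergraph n) → IsLinSaturatedC3 k H → m ≤ length H)

-- floor division (divisor 0 never occurs in the theorem since k ≥ 3)
floorDiv : ℕ → ℕ → ℕ
floorDiv a zero = 0
floorDiv a (suc d) = a / suc d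

-- Upper bound: a star of m = ⌊(n−1)/(k−1)⌋ petals through a common centre,
-- each petal using k−1 fresh vertices, leaves fewer than k−1 vertices
-- uncovered.  Any k-set that can still be added linearly must avoid the
-- centre and meet two distinct petals, closing a triangle through the centre.
--
-- Lower bound: each edge of size k lowers the number of connected components
-- by at most k−1, so h edges leave at least n − h(k−1) components.  If
-- h < ⌊(n−1)/(k−1)⌋ there are at least k components, and a k-set taking one
-- vertex from each of k of them can be added: it meets every edge at most
-- once, and a Berge triangle through it would connect two of its vertices
-- by a path in H.

module Submission where

open import Defs
open import Data.Bool.Base using (if_then_else_)
open import Data.Empty using (⊥-elim)
open import Data.Fin.Base using (Fin; zero; suc; toℕ; fromℕ<)
open import Data.Fin.Properties using (_≟_; any?; toℕ-fromℕ<; toℕ-injective; toℕ<n)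
open import Data.Fin.Subset
  using (Subset; inside; outside; _∈_; _∉_; _⊆_; _∩_; _∪_; ∣_∣; ⁅_⁆; ⊥; ⊤; ⋃)
open import Data.Fin.Subset.Properties
  using ( _∈?_; nonempty?; ⊥⊆; in⊆in; s⊆s; ∣⊥∣≡0; ∣⁅x⁆∣≡1; x∈⁅x⁆; x∈p∪q⁺; x∈p∩q⁺; x∈p∩q⁻
        ; ∣⊤∣≡n; ∩-comm; p⊆q⇒∣p∣≤∣q∣; x∈p⇒∣p-x∣<∣p∣; x∈p∧x≢y⇒x∈p-y )
open import Data.List.Base using (List; []; _∷_; length; map; allFin)
open import Data.List.Properties using (length-map; length-tabulate)
open import Data.List.Membership.Propositional using () renaming (_∈_ to _∈ˡ_)
import Data.List.Membership.DecPropositional as DecMembership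
open import Data.List.Membership.Propositional.Properties using (∈-map⁺; ∈-map⁻; ∈-allFin)
open import Data.List.Relation.Unary.Any using (here; there)
open import Data.List.Relation.Unary.All as All using (All; []; _∷_)
open import Data.List.Relation.Unary.AllPairs using (_∷_)
import Data.List.Relation.Unary.Unique.Propositional.Properties as Unique
open import Data.Nat.Base using (ℕ; zero; suc; _+_; _*_; _∸_; _≤_; _<_; z≤n; s≤s; z<s; NonZero)
open import Data.Nat.Properties hiding (_≟_)
open import Data.Nat.DivMod using (_/_; _%_; m≡m%n+[m/n]*n; m%n<n; m/n*n≤m; m*n/n≡m; m<n*o⇒m/o<n; /-monoˡ-≤)
open import Data.Product using (∃; _×_; _,_; proj₁; proj₂)
import Data.Product as Product
open import Data.Sum using (inj₁; inj₂)
open import Data.Vec.Base using ([]; _∷_; here; there; tabulate)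
open import Data.Vec.Properties using (lookup∘tabulate; []=⇒lookup; lookup⇒[]=)
open import Function using (id)
open import Relation.Binary.PropositionalEquality
open import Relation.Nullary using (¬_; Dec; yes; no; does; contradiction; _×-dec_; ¬?)
open import Relation.Nullary.Decidable using (dec-true)

private
  variable
    n : ℕ
    p q : Subset n
    x y : Fin n

m<n+[m/n]*n : ∀ m n .{{_ : NonZero n}} → m < n + (m / n) * n
m<n+[m/n]*n m n = begin-strict
  m                       ≡⟨ m≡m%n+[m/n]*n m n ⟩
  m % n + (m / n) * n     <⟨ +-monoˡ-< ((m / n) * n) (m%n<n m n) ⟩
  n + (m / n) * n         ∎
  where open ≤-Reasoning

o*n≤m<n+o*n⇒m/n≡o : ∀ {m n o} .{{_ : NonZero n}} → o * n ≤ m → m < n + o * n → m / n ≡ o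
o*n≤m<n+o*n⇒m/n≡o {m} {n} {o} lower upper = ≤-antisym (≤-pred (m<n*o⇒m/o<n upper)) (begin
  o          ≡⟨ m*n/n≡m o n ⟨
  o * n / n  ≤⟨ /-monoˡ-≤ n lower ⟩
  m / n      ∎)
  where open ≤-Reasoning

∣p∪q∣≤∣p∣+∣q∣ : (p q : Subset n) → ∣ p ∪ q ∣ ≤ ∣ p ∣ + ∣ q ∣
∣p∪q∣≤∣p∣+∣q∣ []            []            = z≤n
∣p∪q∣≤∣p∣+∣q∣ (inside ∷ p)  (inside ∷ q)  =
  s≤s (≤-trans (m≤n⇒m≤1+n (∣p∪q∣≤∣p∣+∣q∣ p q)) (≤-reflexive (sym (+-suc ∣ p ∣ ∣ q ∣))))
∣p∪q∣≤∣p∣+∣q∣ (inside ∷ p)  (outside ∷ q) = s≤s (∣p∪q∣≤∣p∣+∣q∣ p q)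
∣p∪q∣≤∣p∣+∣q∣ (outside ∷ p) (inside ∷ q)  =
  ≤-trans (s≤s (∣p∪q∣≤∣p∣+∣q∣ p q)) (≤-reflexive (sym (+-suc ∣ p ∣ ∣ q ∣)))
∣p∪q∣≤∣p∣+∣q∣ (outside ∷ p) (outside ∷ q) = ∣p∪q∣≤∣p∣+∣q∣ p q

p⊆⁅x⁆∪q⇒∣p∣≤1+∣q∣ : p ⊆ ⁅ x ⁆ ∪ q → ∣ p ∣ ≤ suc ∣ q ∣
p⊆⁅x⁆∪q⇒∣p∣≤1+∣q∣ {p = p} {x = x} {q = q} p⊆ = begin
  ∣ p ∣              ≤⟨ p⊆q⇒∣p∣≤∣q∣ p⊆ ⟩
  ∣ ⁅ x ⁆ ∪ q ∣      ≤⟨ ∣p∪q∣≤∣p∣+∣q∣ ⁅ x ⁆ q ⟩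
  ∣ ⁅ x ⁆ ∣ + ∣ q ∣  ≡⟨ cong (_+ ∣ q ∣) (∣⁅x⁆∣≡1 x) ⟩
  suc ∣ q ∣          ∎
  where open ≤-Reasoning

∃-∈-∉-≢ : (p q : Subset n) (x : Fin n) → suc ∣ q ∣ < ∣ p ∣ → ∃ λ v → v ∈ p × v ∉ q × v ≢ x
∃-∈-∉-≢ p q x q<p with any? (λ v → v ∈? p ×-dec (¬? (v ∈? q) ×-dec ¬? (v ≟ x)))
... | yes found = found
... | no none = contradiction (p⊆⁅x⁆∪q⇒∣p∣≤1+∣q∣ p⊆) (<⇒≱ q<p)
  where
  p⊆ : p ⊆ ⁅ x ⁆ ∪ q
  p⊆ {v} v∈p with v ∈? q | v ≟ x
  ... | yes v∈q | _        = x∈p∪q⁺ (inj₂ v∈q)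
  ... | no _    | yes refl = x∈p∪q⁺ (inj₁ (x∈⁅x⁆ v))
  ... | no v∉q  | no v≢x   = ⊥-elim (none (v , v∈p , v∉q , v≢x))

x∈p⇒0<∣p∣ : x ∈ p → 0 < ∣ p ∣
x∈p⇒0<∣p∣ x∈p = ≤-<-trans z≤n (x∈p⇒∣p-x∣<∣p∣ x∈p)

∣p∣≤1⇒x∈p⇒y∈p⇒x≡y : ∣ p ∣ ≤ 1 → x ∈ p → y ∈ p → x ≡ y
∣p∣≤1⇒x∈p⇒y∈p⇒x≡y {x = x} {y = y} ∣p∣≤1 x∈p y∈p with x ≟ y
... | yes x≡y = x≡y
... | no x≢y  = contradiction (≤-trans (s≤s (x∈p⇒0<∣p∣ y∈p-x)) (x∈p⇒∣p-x∣<∣p∣ x∈p)) (<⇒≱ (s≤s ∣p∣≤1))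
  where y∈p-x = x∈p∧x≢y⇒x∈p-y y∈p (≢-sym x≢y)

subsingleton⇒∣p∣≤1 : (∀ {x y} → x ∈ p → y ∈ p → x ≡ y) → ∣ p ∣ ≤ 1
subsingleton⇒∣p∣≤1 {n} {p} unique with nonempty? p
... | yes (x , x∈p) = ≤-trans (p⊆q⇒∣p∣≤∣q∣ p⊆⁅x⁆) (≤-reflexive (∣⁅x⁆∣≡1 x))
  where
  p⊆⁅x⁆ : p ⊆ ⁅ x ⁆
  p⊆⁅x⁆ y∈p = subst (_∈ ⁅ x ⁆) (unique x∈p y∈p) (x∈⁅x⁆ x)
... | no empty = ≤-trans (p⊆q⇒∣p∣≤∣q∣ p⊆⊥) (≤-trans (≤-reflexive (∣⊥∣≡0 n)) z≤n)
  where
  p⊆⊥ : p ⊆ ⊥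
  p⊆⊥ {y} y∈p = ⊥-elim (empty (y , y∈p))

∃-⊆-of-size : (p : Subset n) {k : ℕ} → k ≤ ∣ p ∣ → ∃ λ e → e ⊆ p × ∣ e ∣ ≡ k
∃-⊆-of-size {n} p         {zero}  _        = ⊥ , ⊥⊆ , ∣⊥∣≡0 n
∃-⊆-of-size (inside ∷ p)  {suc k} (s≤s k≤) =
  let e , e⊆p , ∣e∣≡k = ∃-⊆-of-size p k≤ in inside ∷ e , in⊆in e⊆p , cong suc ∣e∣≡k
∃-⊆-of-size (outside ∷ p) {suc k} k≤       =
  let e , e⊆p , ∣e∣≡k = ∃-⊆-of-size p k≤ in outside ∷ e , s⊆s e⊆p , ∣e∣≡k

elements : Subset n → List (Fin n)
elements []            = []
elements (inside ∷ p)  = zero ∷ map suc (elements p)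
elements (outside ∷ p) = map suc (elements p)

length-elements : (p : Subset n) → length (elements p) ≡ ∣ p ∣
length-elements []            = refl
length-elements (inside ∷ p)  = cong suc (trans (length-map suc (elements p)) (length-elements p))
length-elements (outside ∷ p) = trans (length-map suc (elements p)) (length-elements p)

∈-elements : (p : Subset n) → x ∈ p → x ∈ˡ elements p
∈-elements (inside ∷ p)  here        = here refl
∈-elements (inside ∷ p)  (there x∈p) = there (∈-map⁺ suc (∈-elements p x∈p))
∈-elements (outside ∷ p) (there x∈p) = ∈-map⁺ suc (∈-elements p x∈p)

fromList : List (Fin n) → Subset n
fromList xs = ⋃ (map ⁅_⁆ xs)

∈-fromList : {xs : List (Fin n)} → x ∈ˡ xs → x ∈ fromList xs
∈-fromList {x = x} (here refl) = x∈p∪q⁺ (inj₁ (x∈⁅x⁆ x))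
∈-fromList         (there x∈)  = x∈p∪q⁺ (inj₂ (∈-fromList x∈))

∣fromList∣≤length : (xs : List (Fin n)) → ∣ fromList xs ∣ ≤ length xs
∣fromList∣≤length {n} []       = ≤-reflexive (∣⊥∣≡0 n)
∣fromList∣≤length (x ∷ xs) = begin
  ∣ ⁅ x ⁆ ∪ fromList xs ∣          ≤⟨ ∣p∪q∣≤∣p∣+∣q∣ ⁅ x ⁆ (fromList xs) ⟩
  ∣ ⁅ x ⁆ ∣ + ∣ fromList xs ∣      ≡⟨ cong (_+ ∣ fromList xs ∣) (∣⁅x⁆∣≡1 x) ⟩
  suc ∣ fromList xs ∣              ≤⟨ s≤s (∣fromList∣≤length xs) ⟩
  suc (length xs)                  ∎
  where open ≤-Reasoning

interval : ℕ → ℕ → Subset n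
interval {zero}  _       _       = []
interval {suc n} zero    zero    = outside ∷ interval zero zero
interval {suc n} zero    (suc c) = inside ∷ interval zero c
interval {suc n} (suc a) c       = outside ∷ interval a c

∣interval∣ : ∀ a c → a + c ≤ n → ∣ interval {n} a c ∣ ≡ c
∣interval∣ {zero}  zero    zero    _       = refl
∣interval∣ {suc n} zero    zero    _       = ∣interval∣ {n} zero zero z≤n
∣interval∣ {suc n} zero    (suc c) (s≤s h) = cong suc (∣interval∣ zero c h)
∣interval∣ {suc n} (suc a) c       (s≤s h) = ∣interval∣ a c h

∈-interval⁺ : ∀ {a c} → a ≤ toℕ x → toℕ x < a + c → x ∈ interval a c
∈-interval⁺ {x = zero}  {zero}  {suc c} _       _       = here
∈-interval⁺ {x = suc x} {zero}  {suc c} _       (s≤s h) = there (∈-interval⁺ z≤n h)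
∈-interval⁺ {x = suc x} {suc a}         (s≤s l) (s≤s h) = there (∈-interval⁺ l h)

∈-interval⁻ : ∀ {a c} → x ∈ interval a c → a ≤ toℕ x × toℕ x < a + c
∈-interval⁻ {x = zero}  {zero}  {suc c} here      = z≤n , s≤s z≤n
∈-interval⁻ {x = suc x} {zero}  {zero}  (there p) = contradiction (proj₂ (∈-interval⁻ p)) λ ()
∈-interval⁻ {x = suc x} {zero}  {suc c} (there p) = z≤n , s≤s (proj₂ (∈-interval⁻ p))
∈-interval⁻ {x = suc x} {suc a}         (there p) = Product.map s≤s s≤s (∈-interval⁻ p)

-- Connected components

Labelling : ℕ → Set
Labelling n = Fin n → Fin n

fixedPoints : Labelling n → Subset n
fixedPoints r = tabulate (λ v → does (r v ≟ v))

∈-fixedPoints⁺ : {r : Labelling n} → r x ≡ x → x ∈ fixedPoints r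
∈-fixedPoints⁺ {x = x} {r} rx≡x =
  lookup⇒[]= x _ (trans (lookup∘tabulate _ x) (dec-true (r x ≟ x) rx≡x))

∈-fixedPoints⁻ : {r : Labelling n} → x ∈ fixedPoints r → r x ≡ x
∈-fixedPoints⁻ {x = x} {r} x∈ with r x ≟ x | trans (sym (lookup∘tabulate (λ v → does (r v ≟ v)) x)) ([]=⇒lookup x∈)
... | yes rx≡x | _ = rx≡x
... | no _     | ()

_∈ˡ?_ : (x : Fin n) (xs : List (Fin n)) → Dec (x ∈ˡ xs)
_∈ˡ?_ = DecMembership._∈?_ _≟_

-- merge (a ∷ bs) r sends every class meeting bs to the label of a.
merge : List (Fin n) → Labelling n → Labelling n
merge []       r   = r
merge (a ∷ bs) r v = if does (r v ∈ˡ? map r bs) then r a else r v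

merge-respects : (xs : List (Fin n)) (r : Labelling n) → r x ≡ r y → merge xs r x ≡ merge xs r y
merge-respects []       r rx≡ry = rx≡ry
merge-respects (a ∷ bs) r rx≡ry = cong (λ l → if does (l ∈ˡ? map r bs) then r a else l) rx≡ry

merge-∈ : ∀ a bs (r : Labelling n) → r x ∈ˡ map r bs → merge (a ∷ bs) r x ≡ r a
merge-∈ {x = x} a bs r rx∈ with r x ∈ˡ? map r bs
... | yes _   = refl
... | no rx∉ = contradiction rx∈ rx∉

merge-∉ : ∀ a bs (r : Labelling n) → ¬ r x ∈ˡ map r bs → merge (a ∷ bs) r x ≡ r x
merge-∉ {x = x} a bs r rx∉ with r x ∈ˡ? map r bs
... | yes rx∈ = contradiction rx∈ rx∉
... | no _    = refl

merge-joins : (xs : List (Fin n)) (r : Labelling n) → x ∈ˡ xs → y ∈ˡ xs → merge xs r x ≡ merge xs r y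
merge-joins (a ∷ bs) r x∈ y∈ = trans (to-head x∈) (sym (to-head y∈))
  where
  to-head : ∀ {v} → v ∈ˡ a ∷ bs → merge (a ∷ bs) r v ≡ r a
  to-head (here refl) with r a ∈ˡ? map r bs
  ... | yes _ = refl
  ... | no _  = refl
  to-head (there v∈bs) = merge-∈ a bs r (∈-map⁺ r v∈bs)

∣fixedPoints∣-merge : (xs : List (Fin n)) (r : Labelling n) →
                      ∣ fixedPoints r ∣ ≤ ∣ fixedPoints (merge xs r) ∣ + (length xs ∸ 1)
∣fixedPoints∣-merge []       r = ≤-reflexive (sym (+-identityʳ _))
∣fixedPoints∣-merge {n} (a ∷ bs) r = begin
  ∣ fixedPoints r ∣                              ≤⟨ p⊆q⇒∣p∣≤∣q∣ fixed⊆ ⟩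
  ∣ fixedPoints r′ ∪ fromList (map r bs) ∣         ≤⟨ ∣p∪q∣≤∣p∣+∣q∣ (fixedPoints r′) (fromList (map r bs)) ⟩
  ∣ fixedPoints r′ ∣ + ∣ fromList (map r bs) ∣     ≤⟨ +-monoʳ-≤ ∣ fixedPoints r′ ∣ (∣fromList∣≤length (map r bs)) ⟩
  ∣ fixedPoints r′ ∣ + length (map r bs)           ≡⟨ cong (∣ fixedPoints r′ ∣ +_) (length-map r bs) ⟩
  ∣ fixedPoints r′ ∣ + length bs                   ∎
  where
  open ≤-Reasoning
  r′ : Labelling n
  r′ = merge (a ∷ bs) r
  fixed⊆ : fixedPoints r ⊆ fixedPoints r′ ∪ fromList (map r bs)
  fixed⊆ {v} v∈ with r v ∈ˡ? map r bs
  ... | yes rv∈ = x∈p∪q⁺ (inj₂ (∈-fromList (subst (_∈ˡ map r bs) (∈-fixedPoints⁻ {r = r} v∈) rv∈)))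
  ... | no rv∉  = x∈p∪q⁺ (inj₁ (∈-fixedPoints⁺ {r = r′} (trans (merge-∉ a bs r rv∉) (∈-fixedPoints⁻ {r = r} v∈))))

-- components H gives both ends of every edge the same label, and its fixed
-- points have pairwise distinct labels: they represent distinct components.
components : Hypergraph n → Labelling n
components []      = id
components (E ∷ H) = merge (elements E) (components H)

components-constant : {H : Hypergraph n} {E : Subset n} →
                      E ∈ˡ H → x ∈ E → y ∈ E → components H x ≡ components H y
components-constant {H = E ∷ H} (here refl) x∈ y∈ =
  merge-joins (elements E) (components H) (∈-elements E x∈) (∈-elements E y∈)
components-constant {H = F ∷ H} (there E∈) x∈ y∈ =
  merge-respects (elements F) (components H) (components-constant E∈ x∈ y∈)

n≤∣fixedPoints-components∣+h*[k∸1] : ∀ k (H : Hypergraph n) → All (λ E → ∣ E ∣ ≡ k) H →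
                                     n ≤ ∣ fixedPoints (components H) ∣ + length H * (k ∸ 1)
n≤∣fixedPoints-components∣+h*[k∸1] {n} k [] [] = begin
  n                                    ≡⟨ ∣⊤∣≡n n ⟨
  ∣ ⊤ {n} ∣                            ≤⟨ p⊆q⇒∣p∣≤∣q∣ {p = ⊤ {n}} {q = fixedPoints id} (λ _ → ∈-fixedPoints⁺ {r = id} refl) ⟩
  ∣ fixedPoints {n} id ∣               ≡⟨ +-identityʳ _ ⟨
  ∣ fixedPoints {n} id ∣ + 0           ∎
  where open ≤-Reasoning
n≤∣fixedPoints-components∣+h*[k∸1] {n} k (E ∷ H) (∣E∣≡k ∷ sizes) = begin
  n                                          ≤⟨ n≤∣fixedPoints-components∣+h*[k∸1] k H sizes ⟩
  ∣ fixedPoints (components H) ∣ + h * k′     ≤⟨ +-monoˡ-≤ (h * k′) (∣fixedPoints∣-merge (elements E) (components H)) ⟩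
  c + (length (elements E) ∸ 1) + h * k′      ≡⟨ cong (λ s → c + (s ∸ 1) + h * k′) (trans (length-elements E) ∣E∣≡k) ⟩
  c + k′ + h * k′                            ≡⟨ +-assoc c k′ (h * k′) ⟩
  c + (k′ + h * k′)                          ∎
  where
  open ≤-Reasoning
  h = length H
  k′ = k ∸ 1
  c = ∣ fixedPoints (components (E ∷ H)) ∣

module Transversal {H : Hypergraph n} {R : Labelling n}
         (R-constant : ∀ {E x y} → E ∈ˡ H → x ∈ E → y ∈ E → R x ≡ R y)
         {e : Subset n} (R-injective : ∀ {x y} → x ∈ e → y ∈ e → R x ≡ R y → x ≡ y) where

  ∣e∩edge∣≤1 : ∀ {E} → E ∈ˡ H → ∣ e ∩ E ∣ ≤ 1
  ∣e∩edge∣≤1 {E} E∈ = subsingleton⇒∣p∣≤1 λ x∈ y∈ →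
    let x∈e , x∈E = x∈p∩q⁻ e E x∈
        y∈e , y∈E = x∈p∩q⁻ e E y∈
    in R-injective x∈e y∈e (R-constant E∈ x∈E y∈E)

  ∉-edges : 2 ≤ ∣ e ∣ → ¬ e ∈ˡ H
  ∉-edges 2≤∣e∣ e∈ = <⇒≱ 2≤∣e∣ (subsingleton⇒∣p∣≤1 λ x∈ y∈ → R-injective x∈ y∈ (R-constant e∈ x∈ y∈))

  linearUniform-∷ : ∀ {k} → 2 ≤ k → ∣ e ∣ ≡ k → IsLinearUniform k H → IsLinearUniform k (e ∷ H)
  linearUniform-∷ 2≤k ∣e∣≡k (unique , sizes , linear) =
      (All.tabulate (λ E∈ e≡E → e∉ (subst (_∈ˡ H) (sym e≡E) E∈)) ∷ unique)
    , (∣e∣≡k ∷ sizes)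
    , meets
    where
    e∉ = ∉-edges (subst (2 ≤_) (sym ∣e∣≡k) 2≤k)
    meets : ∀ (f g : Subset n) → f ∈ˡ e ∷ H → g ∈ˡ e ∷ H → f ≢ g → ∣ f ∩ g ∣ ≤ 1
    meets f g (here refl) (here refl) f≢g = contradiction refl f≢g
    meets f g (here refl) (there g∈)  _   = ∣e∩edge∣≤1 g∈
    meets f g (there f∈)  (here refl) _   = subst (λ s → ∣ s ∣ ≤ 1) (∩-comm e f) (∣e∩edge∣≤1 f∈)
    meets f g (there f∈)  (there g∈)  f≢g = linear f g f∈ g∈ f≢g

  -- A triangle using e once joins two vertices of e through edges of H.
  ¬BergeC3-∷ : ¬ BergeC3 H → ¬ BergeC3 (e ∷ H)
  ¬BergeC3-∷ triangle-free
    (v₁ , v₂ , v₃ , e₁ , e₂ , e₃ , (v₁≢v₂ , v₂≢v₃ , v₁≢v₃) , e-distinct , (e₁∈ , e₂∈ , e₃∈)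
        , (v₁∈e₁ , v₂∈e₁) , (v₂∈e₂ , v₃∈e₂) , (v₃∈e₃ , v₁∈e₃)) =
    through e-distinct e₁∈ e₂∈ e₃∈ v₁∈e₁ v₂∈e₁ v₂∈e₂ v₃∈e₂ v₃∈e₃ v₁∈e₃
    where
    through : ∀ {e₁ e₂ e₃} → e₁ ≢ e₂ × e₂ ≢ e₃ × e₁ ≢ e₃ →
              e₁ ∈ˡ e ∷ H → e₂ ∈ˡ e ∷ H → e₃ ∈ˡ e ∷ H →
              v₁ ∈ e₁ → v₂ ∈ e₁ → v₂ ∈ e₂ → v₃ ∈ e₂ → v₃ ∈ e₃ → v₁ ∈ e₃ → Data.Empty.⊥
    through (≢₁₂ , _ , _) (here refl) (here refl) _ _ _ _ _ _ _ = ≢₁₂ refl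
    through (_ , ≢₂₃ , _) _ (here refl) (here refl) _ _ _ _ _ _ = ≢₂₃ refl
    through (_ , _ , ≢₁₃) (here refl) _ (here refl) _ _ _ _ _ _ = ≢₁₃ refl
    through _ (here refl) (there p₂) (there p₃) a₁ a₂ b₂ b₃ c₃ c₁ =
      v₁≢v₂ (R-injective a₁ a₂ (trans (R-constant p₃ c₁ c₃) (R-constant p₂ b₃ b₂)))
    through _ (there p₁) (here refl) (there p₃) a₁ a₂ b₂ b₃ c₃ c₁ =
      v₂≢v₃ (R-injective b₂ b₃ (trans (R-constant p₁ a₂ a₁) (R-constant p₃ c₁ c₃)))
    through _ (there p₁) (there p₂) (here refl) a₁ a₂ b₂ b₃ c₃ c₁ =
      v₁≢v₃ (R-injective c₁ c₃ (trans (R-constant p₁ a₁ a₂) (R-constant p₂ b₂ b₃)))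
    through distinct (there p₁) (there p₂) (there p₃) a₁ a₂ b₂ b₃ c₃ c₁ =
      triangle-free (v₁ , v₂ , v₃ , _ , _ , _ , (v₁≢v₂ , v₂≢v₃ , v₁≢v₃) , distinct , (p₁ , p₂ , p₃)
                     , (a₁ , a₂) , (b₂ , b₃) , (c₃ , c₁))

-- Lower bound

saturated⇒∣fixedPoints-components∣<k : ∀ {k} {H : Hypergraph n} → 2 ≤ k → IsLinSaturatedC3 k H →
                                      ∣ fixedPoints (components H) ∣ < k
saturated⇒∣fixedPoints-components∣<k {k = k} {H} 2≤k (linearUniform , triangle-free , saturated)
  with k ≤? ∣ fixedPoints (components H) ∣
... | no k≰ = ≰⇒> k≰
... | yes k≤ = ⊥-elim (¬BergeC3-∷ triangle-free (saturated e ∣e∣≡k e∉H (linearUniform-∷ 2≤k ∣e∣≡k linearUniform)))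
  where
  chosen = ∃-⊆-of-size (fixedPoints (components H)) k≤
  e = proj₁ chosen
  e⊆ = proj₁ (proj₂ chosen)
  ∣e∣≡k = proj₂ (proj₂ chosen)
  components-injective-on-e : ∀ {x y} → x ∈ e → y ∈ e → components H x ≡ components H y → x ≡ y
  components-injective-on-e x∈ y∈ eq = begin
    _                 ≡⟨ ∈-fixedPoints⁻ {r = components H} (e⊆ x∈) ⟨
    components H _    ≡⟨ eq ⟩
    components H _    ≡⟨ ∈-fixedPoints⁻ {r = components H} (e⊆ y∈) ⟩
    _                 ∎
    where open ≡-Reasoning
  open Transversal {H = H} components-constant components-injective-on-e
  e∉H = ∉-edges (subst (2 ≤_) (sym ∣e∣≡k) 2≤k)

saturated⇒[n∸1]/[k∸1]≤length : ∀ n′ d (H : Hypergraph (suc n′)) → IsLinSaturatedC3 (suc (suc d)) H →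
                       n′ / suc d ≤ length H
saturated⇒[n∸1]/[k∸1]≤length n′ d H saturated@((_ , sizes , _) , _) =
  ≤-pred (m<n*o⇒m/o<n (begin-strict
    n′                                       <⟨ n≤∣fixedPoints-components∣+h*[k∸1] (suc (suc d)) H sizes ⟩
    ∣ fixedPoints (components H) ∣ + h * D   ≤⟨ +-monoˡ-≤ (h * D) few-components ⟩
    D + h * D                                ∎))
  where
  open ≤-Reasoning
  D h : ℕ
  D = suc d
  h = length H
  few-components : ∣ fixedPoints (components H) ∣ ≤ D
  few-components = ≤-pred (saturated⇒∣fixedPoints-components∣<k (s≤s (s≤s z≤n)) saturated)

-- Upper bound

-- Vertex 0 is the centre; vertex suc t lies in petal ⌊t/D⌋ when t < m * D
-- and is left over otherwise.
module Star (n′ d : ℕ) where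

  D m : ℕ
  D = suc d
  m = n′ / D

  petal : Fin m → Subset (suc n′)
  petal i = inside ∷ interval (toℕ i * D) D

  leftover : Subset (suc n′)
  leftover = outside ∷ interval (m * D) (n′ % D)

  star : Hypergraph (suc n′)
  star = map petal (allFin m)

  n′≡m*D+n′%D : n′ ≡ m * D + n′ % D
  n′≡m*D+n′%D = trans (m≡m%n+[m/n]*n n′ D) (+-comm (n′ % D) (m * D))

  i*D+D≤n′ : (i : Fin m) → toℕ i * D + D ≤ n′
  i*D+D≤n′ i = begin
    toℕ i * D + D  ≡⟨ +-comm (toℕ i * D) D ⟩
    suc (toℕ i) * D ≤⟨ *-monoˡ-≤ D (toℕ<n i) ⟩
    m * D          ≤⟨ m/n*n≤m n′ D ⟩
    n′             ∎
    where open ≤-Reasoning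

  ∣petal∣ : (i : Fin m) → ∣ petal i ∣ ≡ suc D
  ∣petal∣ i = cong suc (∣interval∣ (toℕ i * D) D (i*D+D≤n′ i))

  ∣leftover∣<D : ∣ leftover ∣ < D
  ∣leftover∣<D = subst (_< D) (sym (∣interval∣ (m * D) (n′ % D) (≤-reflexive (sym n′≡m*D+n′%D)))) (m%n<n n′ D)

  centre∈petal : (i : Fin m) → zero ∈ petal i
  centre∈petal i = here

  ∈-petal⁺ : {t : Fin n′} {i : Fin m} → toℕ t / D ≡ toℕ i → suc t ∈ petal i
  ∈-petal⁺ {t} {i} t/D≡i = there (∈-interval⁺ lower upper)
    where
    lower : toℕ i * D ≤ toℕ t
    lower = subst (λ j → j * D ≤ toℕ t) t/D≡i (m/n*n≤m (toℕ t) D)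
    upper : toℕ t < toℕ i * D + D
    upper = subst (toℕ t <_) (trans (cong (λ j → D + j * D) t/D≡i) (+-comm D (toℕ i * D)))
                  (m<n+[m/n]*n (toℕ t) D)

  ∈-petal⁻ : {t : Fin n′} {i : Fin m} → suc t ∈ petal i → toℕ t / D ≡ toℕ i
  ∈-petal⁻ {t} {i} (there t∈) =
    let lower , upper = ∈-interval⁻ t∈
    in o*n≤m<n+o*n⇒m/n≡o lower (subst (toℕ t <_) (+-comm (toℕ i * D) D) upper)

  ∈-two-petals⇒≡ : {t : Fin n′} {i j : Fin m} → suc t ∈ petal i → suc t ∈ petal j → i ≡ j
  ∈-two-petals⇒≡ t∈i t∈j = toℕ-injective (trans (sym (∈-petal⁻ t∈i)) (∈-petal⁻ t∈j))

  petal-injective : {i j : Fin m} → petal i ≡ petal j → i ≡ j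
  petal-injective {i} {j} Pi≡Pj = ∈-two-petals⇒≡ t∈i (subst (suc t ∈_) Pi≡Pj t∈i)
    where
    i*D<n′ : toℕ i * D < n′
    i*D<n′ = <-≤-trans (m<m+n (toℕ i * D) z<s) (i*D+D≤n′ i)
    t = fromℕ< i*D<n′
    t∈i : suc t ∈ petal i
    t∈i = ∈-petal⁺ (trans (cong (_/ D) (toℕ-fromℕ< i*D<n′)) (m*n/n≡m (toℕ i) D))

  petal∈star : (i : Fin m) → petal i ∈ˡ star
  petal∈star i = ∈-map⁺ petal (∈-allFin i)

  ∈-some-petal : ∀ v → v ≢ zero → v ∉ leftover → ∃ λ i → v ∈ petal i
  ∈-some-petal zero    v≢0 _ = contradiction refl v≢0
  ∈-some-petal (suc t) _   t∉ with m * D ≤? toℕ t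
  ... | yes m*D≤t = contradiction (there (∈-interval⁺ m*D≤t (subst (toℕ t <_) n′≡m*D+n′%D (toℕ<n t)))) t∉
  ... | no m*D≰t  = fromℕ< t/D<m , ∈-petal⁺ (sym (toℕ-fromℕ< t/D<m))
    where
    t/D<m : toℕ t / D < m
    t/D<m = m<n*o⇒m/o<n (≰⇒> m*D≰t)

  shared⇒centre : ∀ {E F v} → E ∈ˡ star → F ∈ˡ star → E ≢ F → v ∈ E → v ∈ F → v ≡ zero
  shared⇒centre {v = zero}  _  _  _   _   _   = refl
  shared⇒centre {v = suc t} E∈ F∈ E≢F t∈E t∈F with ∈-map⁻ petal E∈ | ∈-map⁻ petal F∈
  ... | i , _ , refl | j , _ , refl = contradiction (cong petal (∈-two-petals⇒≡ {i = i} {j} t∈E t∈F)) E≢F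

  star-linearUniform : IsLinearUniform (suc D) star
  star-linearUniform =
      Unique.map⁺ petal-injective (Unique.allFin⁺ m)
    , All.tabulate size
    , λ E F E∈ F∈ E≢F → subsingleton⇒∣p∣≤1 λ x∈ y∈ →
        let centre = λ {v} v∈ → let v∈E , v∈F = x∈p∩q⁻ E F v∈ in shared⇒centre {v = v} E∈ F∈ E≢F v∈E v∈F
        in trans (centre x∈) (sym (centre y∈))
    where
    size : ∀ {E} → E ∈ˡ star → ∣ E ∣ ≡ suc D
    size E∈ with ∈-map⁻ petal E∈
    ... | i , _ , refl = ∣petal∣ i

  star-triangle-free : ¬ BergeC3 star
  star-triangle-free (_ , v₂ , v₃ , _ , _ , _ , (_ , v₂≢v₃ , _) , (e₁≢e₂ , e₂≢e₃ , _) , (e₁∈ , e₂∈ , e₃∈)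
                     , (_ , v₂∈e₁) , (v₂∈e₂ , v₃∈e₂) , (v₃∈e₃ , _)) =
    v₂≢v₃ (trans (shared⇒centre e₁∈ e₂∈ e₁≢e₂ v₂∈e₁ v₂∈e₂) (sym (shared⇒centre e₂∈ e₃∈ e₂≢e₃ v₃∈e₂ v₃∈e₃)))

  -- e has more than ∣ leftover ∣ + 1 vertices, so besides any given vertex it
  -- has one outside leftover, which lies in a petal; as e meets each petal at
  -- most once, this rules out the centre and gives two vertices in distinct
  -- petals.
  star-saturated : ∀ e → ∣ e ∣ ≡ suc D → ¬ e ∈ˡ star → IsLinearUniform (suc D) (e ∷ star) →
                   BergeC3 (e ∷ star)
  star-saturated e ∣e∣≡k e∉ (_ , _ , linear) =
    let v , v∈e , v≢0 , _   , i , v∈Pi = off-centre zero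
        w , w∈e , w≢0 , w≢v , j , w∈Pj = off-centre v
    in  zero , v , w , petal i , e , petal j
      , (≢-sym v≢0 , ≢-sym w≢v , ≢-sym w≢0)
      , ( ≢-sym (e≢petal i) , e≢petal j
        , λ Pi≡Pj → w≢v (meets-petal-once i w∈e v∈e (subst (w ∈_) (sym Pi≡Pj) w∈Pj) v∈Pi))
      , (there (petal∈star i) , here refl , there (petal∈star j))
      , (centre∈petal i , v∈Pi)
      , (v∈e , w∈e)
      , (w∈Pj , centre∈petal j)
    where
    e≢petal : ∀ i → e ≢ petal i
    e≢petal i e≡Pi = e∉ (subst (_∈ˡ star) (sym e≡Pi) (petal∈star i))

    meets-petal-once : ∀ i {x y} → x ∈ e → y ∈ e → x ∈ petal i → y ∈ petal i → x ≡ y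
    meets-petal-once i x∈e y∈e x∈Pi y∈Pi =
      ∣p∣≤1⇒x∈p⇒y∈p⇒x≡y (linear e (petal i) (here refl) (there (petal∈star i)) (e≢petal i))
                        (x∈p∩q⁺ (x∈e , x∈Pi)) (x∈p∩q⁺ (y∈e , y∈Pi))

    escape : ∀ x → ∃ λ v → v ∈ e × v ∉ leftover × v ≢ x
    escape x = ∃-∈-∉-≢ e leftover x (subst (suc ∣ leftover ∣ <_) (sym ∣e∣≡k) (s≤s ∣leftover∣<D))

    centre∉e : zero ∉ e
    centre∉e 0∈e =
      let v , v∈e , v∉L , v≢0 = escape zero
          i , v∈Pi = ∈-some-petal v v≢0 v∉L
      in v≢0 (meets-petal-once i v∈e 0∈e v∈Pi (centre∈petal i))

    off-centre : ∀ x → ∃ λ v → v ∈ e × v ≢ zero × v ≢ x × ∃ λ i → v ∈ petal i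
    off-centre x =
      let v , v∈e , v∉L , v≢x = escape x
          v≢0 = λ v≡0 → centre∉e (subst (_∈ e) v≡0 v∈e)
      in v , v∈e , v≢0 , v≢x , ∈-some-petal v v≢0 v∉L

  star-linSaturated : IsLinSaturatedC3 (suc D) star
  star-linSaturated = star-linearUniform , star-triangle-free , star-saturated

  length-star : length star ≡ m
  length-star = trans (length-map petal (allFin m)) (length-tabulate id)

theorem1p3 : ∀ (n k : ℕ) → 6 ≤ n → 3 ≤ k
    → IsLinSatNumberC3 n k (floorDiv (n ∸ 1) (k ∸ 1))
theorem1p3 (suc n′) (suc (suc d)) _ _ =
    (star , star-linSaturated , length-star)
  , saturated⇒[n∸1]/[k∸1]≤length n′ d
  where open Star n′ d
theorem1p3 zero    _             ()
theorem1p3 (suc _) zero          _  ()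
theorem1p3 (suc _) (suc zero)    _  (s≤s ())
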